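{- Let $\mathcal{E}$ be a topos which is a model of guarded recursive terms, let $X$ be an object and $m:M\to X$ a subobject of $X$. If $\rhd(m)\le m$ in $\mathrm{Sub}(X)$, then $m$ is the maximal subobject of $X$.
   Context: A model of guarded recursive terms: a category with finite products, an endofunctor $\blacktriangleright$ preserving finite limits and a natural transformation $\mathrm{next}:\mathrm{id}\to\blacktriangleright$ such that every $f:\blacktriangleright X\to X$ has a unique $h:1\to X$ with $f\circ\mathrm{next}\circ h=h$. For a subobject $m:M\to X$, $\rhd(m)$ is the pullback of $\blacktriangleright m:\blacktriangleright M\to\blacktriangleright X$ along $\mathrm{next}_X:X\to\blacktriangleright X$. -}

module Defs where

open import Level using (Level; _⊔_) renaming (suc to lsuc)
open import Data.Product using (Σ; _×_; _,_; proj₁; proj₂; Σ-syntax)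
open import Relation.Binary using (Rel; IsEquivalence)

record Category (o ℓ e : Level) : Set (lsuc (o ⊔ ℓ ⊔ e)) where
  infixr 9 _∘_
  infix  4 _≈_
  field
    Obj  : Set o
    _⇒_  : Obj → Obj → Set ℓ
    _≈_  : ∀ {A B} → Rel (A ⇒ B) e
    id   : ∀ {A} → A ⇒ A
    _∘_  : ∀ {A B C} → B ⇒ C → A ⇒ B → A ⇒ C
    equiv     : ∀ {A B} → IsEquivalence (_≈_ {A} {B})
    assoc     : ∀ {A B C D} {f : A ⇒ B} {g : B ⇒ C} {h : C ⇒ D} →
                (h ∘ g) ∘ f ≈ h ∘ (g ∘ f)
    identityˡ : ∀ {A B} {f : A ⇒ B} → id ∘ f ≈ f
    identityʳ : ∀ {A B} {f : A ⇒ B} → f ∘ id ≈ f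
    ∘-resp-≈  : ∀ {A B C} {f h : B ⇒ C} {g i : A ⇒ B} →
                f ≈ h → g ≈ i → f ∘ g ≈ h ∘ i

module _ {o ℓ e : Level} (C : Category o ℓ e) where
  open Category C

  Mono : ∀ {A B} → A ⇒ B → Set (o ⊔ ℓ ⊔ e)
  Mono {A} f = ∀ {Z} (g h : Z ⇒ A) → f ∘ g ≈ f ∘ h → g ≈ h

  record IsTerminal (T : Obj) : Set (o ⊔ ℓ ⊔ e) where
    field
      ! : ∀ {A} → A ⇒ T
      !-unique : ∀ {A} (f : A ⇒ T) → f ≈ !

  record IsProduct {A B P : Obj} (π₁ : P ⇒ A) (π₂ : P ⇒ B) : Set (o ⊔ ℓ ⊔ e) where
    field
      pair   : ∀ {Z} (f : Z ⇒ A) (g : Z ⇒ B) → Σ[ h ∈ Z ⇒ P ] (π₁ ∘ h ≈ f × π₂ ∘ h ≈ g)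
      unique : ∀ {Z} (h k : Z ⇒ P) → π₁ ∘ h ≈ π₁ ∘ k → π₂ ∘ h ≈ π₂ ∘ k → h ≈ k

  record IsPullback {A B D P : Obj} (f : A ⇒ D) (g : B ⇒ D) (p₁ : P ⇒ A) (p₂ : P ⇒ B)
         : Set (o ⊔ ℓ ⊔ e) where
    field
      commute   : f ∘ p₁ ≈ g ∘ p₂
      universal : ∀ {Z} (q₁ : Z ⇒ A) (q₂ : Z ⇒ B) → f ∘ q₁ ≈ g ∘ q₂ →
                  Σ[ u ∈ Z ⇒ P ] (p₁ ∘ u ≈ q₁ × p₂ ∘ u ≈ q₂)
      unique    : ∀ {Z} (u v : Z ⇒ P) → p₁ ∘ u ≈ p₁ ∘ v → p₂ ∘ u ≈ p₂ ∘ v → u ≈ v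

  record Pullback {A B D : Obj} (f : A ⇒ D) (g : B ⇒ D) : Set (o ⊔ ℓ ⊔ e) where
    field
      P  : Obj
      p₁ : P ⇒ A
      p₂ : P ⇒ B
      isPullback : IsPullback f g p₁ p₂

  record Endofunctor : Set (o ⊔ ℓ ⊔ e) where
    field
      F₀ : Obj → Obj
      F₁ : ∀ {A B} → A ⇒ B → F₀ A ⇒ F₀ B
      identity     : ∀ {A} → F₁ (id {A}) ≈ id
      homomorphism : ∀ {A B D} {f : A ⇒ B} {g : B ⇒ D} → F₁ (g ∘ f) ≈ F₁ g ∘ F₁ f
      F-resp-≈     : ∀ {A B} {f g : A ⇒ B} → f ≈ g → F₁ f ≈ F₁ g

  -- Preorder on subobjects of X (represented by monos into X):
  -- n ≤ m  iff  n factors through m.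
  _≤ₛ_ : ∀ {M N X} → N ⇒ X → M ⇒ X → Set (ℓ ⊔ e)
  _≤ₛ_ {M} {N} n m = Σ[ k ∈ N ⇒ M ] (m ∘ k ≈ n)

record Topos (o ℓ e : Level) : Set (lsuc (o ⊔ ℓ ⊔ e)) where
  field
    cat : Category o ℓ e
  open Category cat
  field
    ⊤          : Obj
    ⊤-terminal : IsTerminal cat ⊤
    _×ₒ_       : Obj → Obj → Obj
    π₁         : ∀ {A B} → (A ×ₒ B) ⇒ A
    π₂         : ∀ {A B} → (A ×ₒ B) ⇒ B
    ×-product  : ∀ {A B} → IsProduct cat (π₁ {A} {B}) π₂
    pullback   : ∀ {A B D} (f : A ⇒ D) (g : B ⇒ D) → Pullback cat f g
  open IsTerminal ⊤-terminal public
  _⁂id : ∀ {A D E} → D ⇒ E → (D ×ₒ A) ⇒ (E ×ₒ A)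
  g ⁂id = proj₁ (IsProduct.pair ×-product (g ∘ π₁) π₂)
  field
    _^_        : Obj → Obj → Obj
    eval       : ∀ {A B} → ((B ^ A) ×ₒ A) ⇒ B
    curry      : ∀ {A B D} (f : (D ×ₒ A) ⇒ B) → Σ[ g ∈ D ⇒ (B ^ A) ] (eval ∘ (g ⁂id) ≈ f)
    curry-unique : ∀ {A B D} (f : (D ×ₒ A) ⇒ B) (g h : D ⇒ (B ^ A)) →
                   eval ∘ (g ⁂id) ≈ f → eval ∘ (h ⁂id) ≈ f → g ≈ h
    Ω          : Obj
    true       : ⊤ ⇒ Ω
    classify   : ∀ {M X} (m : M ⇒ X) → Mono cat m →
                 Σ[ χ ∈ X ⇒ Ω ] IsPullback cat χ true m !
    classify-unique : ∀ {M X} (m : M ⇒ X) → Mono cat m → (χ χ′ : X ⇒ Ω) →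
                 IsPullback cat χ true m ! → IsPullback cat χ′ true m ! → χ ≈ χ′

record GuardedModel {o ℓ e : Level} (𝓔 : Topos o ℓ e) : Set (o ⊔ ℓ ⊔ e) where
  open Topos 𝓔
  open Category cat
  field
    ▶F : Endofunctor cat
  open Endofunctor ▶F public renaming (F₀ to ▶; F₁ to ▶₁)
  field
    ▶-pres-terminal : IsTerminal cat (▶ ⊤)
    ▶-pres-pullback : ∀ {A B D P} {f : A ⇒ D} {g : B ⇒ D} {p₁ : P ⇒ A} {p₂ : P ⇒ B} →
                      IsPullback cat f g p₁ p₂ →
                      IsPullback cat (▶₁ f) (▶₁ g) (▶₁ p₁) (▶₁ p₂)
    next            : ∀ X → X ⇒ ▶ X
    next-natural    : ∀ {A B} (f : A ⇒ B) → next B ∘ f ≈ ▶₁ f ∘ next A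
    fix             : ∀ {X} (f : ▶ X ⇒ X) → Σ[ h ∈ ⊤ ⇒ X ] (f ∘ next X ∘ h ≈ h)
    fix-unique      : ∀ {X} (f : ▶ X ⇒ X) (h h′ : ⊤ ⇒ X) →
                      f ∘ next X ∘ h ≈ h → f ∘ next X ∘ h′ ≈ h′ → h ≈ h′

  ▷ : ∀ {M X} → (m : M ⇒ X) → Pullback.P (pullback (next X) (▶₁ m)) ⇒ X
  ▷ {M} {X} m = Pullback.p₁ (pullback (next X) (▶₁ m))

module Submission where

-- Let `later : ▶Ω → Ω` classify the global element ▶true, and call a
-- predicate φ : X → Ω later-stable if later ∘ next ∘ φ = φ.
--   (1) If ▷(m) ≤ m, the characteristic map χₘ is later-stable: the map
--       later ∘ next ∘ χₘ classifies m as well, so it equals χₘ.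
--   (2) All later-stable predicates on X coincide.  Their names ⌜φ⌝ : 1 → Ω^X
--       are fixed points of the guarded map Φ : ▶(Ω^X) → Ω^X,
--       Φ(▶ψ)(x) = later(▶ψ (next x)), and fixed points are unique.
--   (3) `true ∘ !` is later-stable, so χₘ = true ∘ !, i.e. m is total.

open import Defs
open import Level using (Level)
open import Data.Product using (_×_; _,_; proj₁; proj₂; Σ-syntax)
open import Relation.Binary using (Setoid)
import Relation.Binary.Reasoning.Setoid as SetoidReasoning

module CategoryReasoning {o ℓ e : Level} (C : Category o ℓ e) where
  open Category C

  hom-setoid : ∀ {A B : Obj} → Setoid ℓ e
  hom-setoid {A} {B} = record { Carrier = A ⇒ B ; _≈_ = _≈_ ; isEquivalence = equiv }

  module _ {A B : Obj} where
    open Setoid (hom-setoid {A} {B}) public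
      using () renaming (refl to ≈-refl; sym to ≈-sym; trans to ≈-trans)
    open SetoidReasoning (hom-setoid {A} {B}) public
      using (begin_; _∎; step-≈-⟩; step-≈-⟨)

  ∘-congˡ : ∀ {A B D} {h : B ⇒ D} {f g : A ⇒ B} → f ≈ g → h ∘ f ≈ h ∘ g
  ∘-congˡ p = ∘-resp-≈ ≈-refl p

  ∘-congʳ : ∀ {A B D} {h : A ⇒ B} {f g : B ⇒ D} → f ≈ g → f ∘ h ≈ g ∘ h
  ∘-congʳ p = ∘-resp-≈ p ≈-refl

  sym-assoc : ∀ {A B D E} {f : A ⇒ B} {g : B ⇒ D} {h : D ⇒ E} →
              h ∘ (g ∘ f) ≈ (h ∘ g) ∘ f
  sym-assoc = ≈-sym assoc

  terminal-unique : ∀ {T A} → IsTerminal C T → (f g : A ⇒ T) → f ≈ g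
  terminal-unique t f g = ≈-trans (IsTerminal.!-unique t f) (≈-sym (IsTerminal.!-unique t g))

  ≤ₛ-trans : ∀ {A B D X} {f : A ⇒ X} {g : B ⇒ X} {h : D ⇒ X} →
             _≤ₛ_ C f g → _≤ₛ_ C g h → _≤ₛ_ C f h
  ≤ₛ-trans {f = f} {g} {h} (k , gk≈f) (l , hl≈g) = l ∘ k , (begin
    h ∘ (l ∘ k)  ≈⟨ sym-assoc ⟩
    (h ∘ l) ∘ k  ≈⟨ ∘-congʳ hl≈g ⟩
    g ∘ k        ≈⟨ gk≈f ⟩
    f            ∎)

module ToposFacts {o ℓ e : Level} (𝓔 : Topos o ℓ e) where
  open Topos 𝓔
  open Category cat
  open CategoryReasoning cat

  ⟨_,_⟩ : ∀ {Z A B} → Z ⇒ A → Z ⇒ B → Z ⇒ (A ×ₒ B)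
  ⟨ f , g ⟩ = proj₁ (IsProduct.pair ×-product f g)

  ⟨⟩-π₂ : ∀ {Z A B} (f : Z ⇒ A) (g : Z ⇒ B) → π₂ ∘ ⟨ f , g ⟩ ≈ g
  ⟨⟩-π₂ f g = proj₂ (proj₂ (IsProduct.pair ×-product f g))

  ⁂id-π₁ : ∀ {A D E} (g : D ⇒ E) → π₁ ∘ (_⁂id {A} g) ≈ g ∘ π₁
  ⁂id-π₁ g = proj₁ (proj₂ (IsProduct.pair ×-product (g ∘ π₁) π₂))

  ⁂id-π₂ : ∀ {A D E} (g : D ⇒ E) → π₂ ∘ (_⁂id {A} g) ≈ π₂
  ⁂id-π₂ g = proj₂ (proj₂ (IsProduct.pair ×-product (g ∘ π₁) π₂))

  ⁂id-resp : ∀ {A D E} {f g : D ⇒ E} → f ≈ g → _⁂id {A} f ≈ g ⁂id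
  ⁂id-resp {f = f} {g} f≈g = IsProduct.unique ×-product _ _
    (begin π₁ ∘ (f ⁂id) ≈⟨ ⁂id-π₁ f ⟩ f ∘ π₁ ≈⟨ ∘-congʳ f≈g ⟩ g ∘ π₁ ≈⟨ ⁂id-π₁ g ⟨ π₁ ∘ (g ⁂id) ∎)
    (≈-trans (⁂id-π₂ f) (≈-sym (⁂id-π₂ g)))

  ⁂id-∘ : ∀ {A B D E} (f : D ⇒ E) (g : B ⇒ D) → _⁂id {A} (f ∘ g) ≈ (f ⁂id) ∘ (g ⁂id)
  ⁂id-∘ f g = IsProduct.unique ×-product _ _
    (begin
      π₁ ∘ ((f ∘ g) ⁂id)           ≈⟨ ⁂id-π₁ (f ∘ g) ⟩
      (f ∘ g) ∘ π₁                 ≈⟨ assoc ⟩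
      f ∘ (g ∘ π₁)                 ≈⟨ ∘-congˡ (⁂id-π₁ g) ⟨
      f ∘ (π₁ ∘ (g ⁂id))           ≈⟨ sym-assoc ⟩
      (f ∘ π₁) ∘ (g ⁂id)           ≈⟨ ∘-congʳ (⁂id-π₁ f) ⟨
      (π₁ ∘ (f ⁂id)) ∘ (g ⁂id)     ≈⟨ assoc ⟩
      π₁ ∘ ((f ⁂id) ∘ (g ⁂id))     ∎)
    (begin
      π₂ ∘ ((f ∘ g) ⁂id)           ≈⟨ ⁂id-π₂ (f ∘ g) ⟩
      π₂                           ≈⟨ ⁂id-π₂ g ⟨
      π₂ ∘ (g ⁂id)                 ≈⟨ ∘-congʳ (⁂id-π₂ f) ⟨
      (π₂ ∘ (f ⁂id)) ∘ (g ⁂id)     ≈⟨ assoc ⟩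
      π₂ ∘ ((f ⁂id) ∘ (g ⁂id))     ∎)

  product-is-pullback : ∀ {A B} → IsPullback cat (! {A}) (! {B}) π₁ π₂
  product-is-pullback = record
    { commute   = terminal-unique ⊤-terminal _ _
    ; universal = λ q₁ q₂ _ → IsProduct.pair ×-product q₁ q₂
    ; unique    = IsProduct.unique ×-product
    }

  eval-⁂id-∘ : ∀ {A B D E} (f : D ⇒ (B ^ A)) (c : E ⇒ D) →
               eval ∘ ((f ∘ c) ⁂id) ≈ (eval ∘ (f ⁂id)) ∘ (c ⁂id)
  eval-⁂id-∘ f c = ≈-trans (∘-congˡ (⁂id-∘ f c)) sym-assoc

  ⌜_⌝ : ∀ {X B} → X ⇒ B → ⊤ ⇒ (B ^ X)
  ⌜ f ⌝ = proj₁ (curry (f ∘ π₂))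

  ⌜⌝-spec : ∀ {X B} (f : X ⇒ B) → eval ∘ (⌜ f ⌝ ⁂id) ≈ f ∘ π₂
  ⌜⌝-spec f = proj₂ (curry (f ∘ π₂))

  -- An arrow is recovered from its name, so naming is injective.
  ⌜⌝-injective : ∀ {X B} {f g : X ⇒ B} → ⌜ f ⌝ ≈ ⌜ g ⌝ → f ≈ g
  ⌜⌝-injective {f = f} {g} ⌜f⌝≈⌜g⌝ = begin
    f                                     ≈⟨ recover f ⟩
    (eval ∘ (⌜ f ⌝ ⁂id)) ∘ ⟨ ! , id ⟩     ≈⟨ ∘-congʳ (∘-congˡ (⁂id-resp ⌜f⌝≈⌜g⌝)) ⟩
    (eval ∘ (⌜ g ⌝ ⁂id)) ∘ ⟨ ! , id ⟩     ≈⟨ recover g ⟨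
    g                                     ∎
    where
      recover : ∀ {X B} (h : X ⇒ B) → h ≈ (eval ∘ (⌜ h ⌝ ⁂id)) ∘ ⟨ ! , id ⟩
      recover h = begin
        h                          ≈⟨ identityʳ ⟨
        h ∘ id                     ≈⟨ ∘-congˡ (⟨⟩-π₂ ! id) ⟨
        h ∘ (π₂ ∘ ⟨ ! , id ⟩)      ≈⟨ sym-assoc ⟩
        (h ∘ π₂) ∘ ⟨ ! , id ⟩      ≈⟨ ∘-congʳ (⌜⌝-spec h) ⟨
        (eval ∘ (⌜ h ⌝ ⁂id)) ∘ ⟨ ! , id ⟩ ∎

  classified-by-true⇒total : ∀ {N X} {n : N ⇒ X} {χ : X ⇒ Ω} →
    IsPullback cat χ true n ! → χ ≈ true ∘ ! → _≤ₛ_ cat (id {X}) n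
  classified-by-true⇒total χ-pb χ≈true =
    let (u , nu≈id , _) = IsPullback.universal χ-pb id ! (≈-trans identityʳ χ≈true)
    in u , nu≈id

module GuardedFacts {o ℓ e : Level} (𝓔 : Topos o ℓ e) (G : GuardedModel 𝓔) where
  open Topos 𝓔
  open Category cat
  open GuardedModel G
  open CategoryReasoning cat
  open ToposFacts 𝓔

  ▷-intro : ∀ {M X Z} (m : M ⇒ X) {q : Z ⇒ X} (v : Z ⇒ ▶ M) →
            ▶₁ m ∘ v ≈ next X ∘ q → _≤ₛ_ cat q (▷ m)
  ▷-intro m {q} v ▶mv≈nextq =
    let (t , ▷mt≈q , _) = IsPullback.universal (Pullback.isPullback (pullback _ (▶₁ m)))
                            q v (≈-sym ▶mv≈nextq)
    in t , ▷mt≈q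

  -- ▶1 is terminal, so ▶true : ▶1 → ▶Ω is a global element, hence mono.
  ▶true-mono : Mono cat (▶₁ true)
  ▶true-mono g h _ = terminal-unique ▶-pres-terminal g h

  later : ▶ Ω ⇒ Ω
  later = proj₁ (classify (▶₁ true) ▶true-mono)

  later-classifies : IsPullback cat later true (▶₁ true) !
  later-classifies = proj₂ (classify (▶₁ true) ▶true-mono)

  LaterStable : ∀ {X} → X ⇒ Ω → Set e
  LaterStable φ = later ∘ next Ω ∘ φ ≈ φ

  true-later-stable : ∀ {X} → LaterStable (true ∘ ! {X})
  true-later-stable = begin
    later ∘ next Ω ∘ true ∘ !         ≈⟨ ∘-congˡ sym-assoc ⟩
    later ∘ (next Ω ∘ true) ∘ !       ≈⟨ ∘-congˡ (∘-congʳ (next-natural true)) ⟩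
    later ∘ (▶₁ true ∘ next ⊤) ∘ !    ≈⟨ ∘-congˡ assoc ⟩
    later ∘ ▶₁ true ∘ next ⊤ ∘ !      ≈⟨ sym-assoc ⟩
    (later ∘ ▶₁ true) ∘ next ⊤ ∘ !    ≈⟨ ∘-congʳ (IsPullback.commute later-classifies) ⟩
    (true ∘ !) ∘ next ⊤ ∘ !           ≈⟨ assoc ⟩
    true ∘ ! ∘ next ⊤ ∘ !             ≈⟨ ∘-congˡ (terminal-unique ⊤-terminal _ _) ⟩
    true ∘ !                          ∎

  later-χ⇒▷ : ∀ {N X Z} {n : N ⇒ X} {χ : X ⇒ Ω} → IsPullback cat χ true n ! →
              (q : Z ⇒ X) {r : Z ⇒ ⊤} → (later ∘ next Ω ∘ χ) ∘ q ≈ true ∘ r →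
              _≤ₛ_ cat q (▷ n)
  later-χ⇒▷ {N} {X} {Z} {n} {χ} χ-pb q {r} holds = ▷-intro n v ▶nv≈nextq
    where
      later-holds : later ∘ next Ω ∘ χ ∘ q ≈ true ∘ r
      later-holds = ≈-trans (∘-congˡ sym-assoc) (≈-trans sym-assoc holds)
      w : Z ⇒ ▶ ⊤
      w = proj₁ (IsPullback.universal later-classifies _ r later-holds)
      ▶true-w : ▶₁ true ∘ w ≈ next Ω ∘ χ ∘ q
      ▶true-w = proj₁ (proj₂ (IsPullback.universal later-classifies _ r later-holds))
      ▶χ-next : ▶₁ χ ∘ next X ∘ q ≈ ▶₁ true ∘ w
      ▶χ-next = begin
        ▶₁ χ ∘ next X ∘ q      ≈⟨ sym-assoc ⟩
        (▶₁ χ ∘ next X) ∘ q    ≈⟨ ∘-congʳ (next-natural χ) ⟨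
        (next Ω ∘ χ) ∘ q       ≈⟨ assoc ⟩
        next Ω ∘ χ ∘ q         ≈⟨ ▶true-w ⟨
        ▶₁ true ∘ w            ∎
      ▶χ-pb : IsPullback cat (▶₁ χ) (▶₁ true) (▶₁ n) (▶₁ !)
      ▶χ-pb = ▶-pres-pullback χ-pb
      v : Z ⇒ ▶ N
      v = proj₁ (IsPullback.universal ▶χ-pb _ w ▶χ-next)
      ▶nv≈nextq : ▶₁ n ∘ v ≈ next X ∘ q
      ▶nv≈nextq = proj₁ (proj₂ (IsPullback.universal ▶χ-pb _ w ▶χ-next))

  -- Fact (1): the characteristic map of a ▷-closed subobject is later-stable,
  -- because later ∘ next ∘ χₙ classifies n too.
  ▷-closed⇒later-stable : ∀ {N X} {n : N ⇒ X} {χ : X ⇒ Ω} → Mono cat n →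
    IsPullback cat χ true n ! → _≤ₛ_ cat (▷ n) n → LaterStable χ
  ▷-closed⇒later-stable {n = n} {χ} n-mono χ-pb ▷n≤n =
    classify-unique n n-mono _ χ later-next-χ-classifies χ-pb
    where
      later-next-χ-classifies : IsPullback cat (later ∘ next Ω ∘ χ) true n !
      later-next-χ-classifies = record
        { commute   = begin
            (later ∘ next Ω ∘ χ) ∘ n   ≈⟨ ≈-trans assoc (∘-congˡ assoc) ⟩
            later ∘ next Ω ∘ χ ∘ n     ≈⟨ ∘-congˡ (∘-congˡ (IsPullback.commute χ-pb)) ⟩
            later ∘ next Ω ∘ true ∘ !  ≈⟨ true-later-stable ⟩
            true ∘ !                   ∎
        ; universal = λ q _ holds →
            let (u , nu≈q) = ≤ₛ-trans (later-χ⇒▷ χ-pb q holds) ▷n≤n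
            in u , nu≈q , terminal-unique ⊤-terminal _ _
        ; unique    = λ u v nu≈nv _ → n-mono u v nu≈nv
        }

  module LaterStableUnique (X : Obj) where
    Y : Obj
    Y = Ω ^ X

    E : Obj
    E = Y ×ₒ X

    -- The comparison ▶Y × X → ▶(Y × X), pairing ▶Y with next on X; it exists
    -- because ▶ preserves the product Y × X as a pullback over 1.
    ▶-product : IsPullback cat (▶₁ (! {Y})) (▶₁ (! {X})) (▶₁ π₁) (▶₁ π₂)
    ▶-product = ▶-pres-pullback product-is-pullback

    θ-exists : Σ[ θ ∈ (▶ Y ×ₒ X) ⇒ ▶ E ] (▶₁ π₁ ∘ θ ≈ π₁ × ▶₁ π₂ ∘ θ ≈ next X ∘ π₂)
    θ-exists = IsPullback.universal ▶-product π₁ (next X ∘ π₂)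
                 (terminal-unique ▶-pres-terminal _ _)

    θ : (▶ Y ×ₒ X) ⇒ ▶ E
    θ = proj₁ θ-exists

    θ-next : θ ∘ (next Y ⁂id) ≈ next E
    θ-next = IsPullback.unique ▶-product _ _
      (begin
        ▶₁ π₁ ∘ θ ∘ (next Y ⁂id)      ≈⟨ sym-assoc ⟩
        (▶₁ π₁ ∘ θ) ∘ (next Y ⁂id)    ≈⟨ ∘-congʳ (proj₁ (proj₂ θ-exists)) ⟩
        π₁ ∘ (next Y ⁂id)             ≈⟨ ⁂id-π₁ (next Y) ⟩
        next Y ∘ π₁                   ≈⟨ next-natural π₁ ⟩
        ▶₁ π₁ ∘ next E                ∎)
      (begin
        ▶₁ π₂ ∘ θ ∘ (next Y ⁂id)      ≈⟨ sym-assoc ⟩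
        (▶₁ π₂ ∘ θ) ∘ (next Y ⁂id)    ≈⟨ ∘-congʳ (proj₂ (proj₂ θ-exists)) ⟩
        (next X ∘ π₂) ∘ (next Y ⁂id)  ≈⟨ assoc ⟩
        next X ∘ π₂ ∘ (next Y ⁂id)    ≈⟨ ∘-congˡ (⁂id-π₂ (next Y)) ⟩
        next X ∘ π₂                   ≈⟨ next-natural π₂ ⟩
        ▶₁ π₂ ∘ next E                ∎)

    Φ : ▶ Y ⇒ Y
    Φ = proj₁ (curry (later ∘ ▶₁ eval ∘ θ))

    Φ-next : eval ∘ ((Φ ∘ next Y) ⁂id) ≈ later ∘ next Ω ∘ eval
    Φ-next = begin
      eval ∘ ((Φ ∘ next Y) ⁂id)              ≈⟨ eval-⁂id-∘ Φ (next Y) ⟩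
      (eval ∘ (Φ ⁂id)) ∘ (next Y ⁂id)        ≈⟨ ∘-congʳ (proj₂ (curry (later ∘ ▶₁ eval ∘ θ))) ⟩
      (later ∘ ▶₁ eval ∘ θ) ∘ (next Y ⁂id)   ≈⟨ ≈-trans assoc (∘-congˡ assoc) ⟩
      later ∘ ▶₁ eval ∘ θ ∘ (next Y ⁂id)     ≈⟨ ∘-congˡ (∘-congˡ θ-next) ⟩
      later ∘ ▶₁ eval ∘ next E               ≈⟨ ∘-congˡ (next-natural eval) ⟨
      later ∘ next Ω ∘ eval                  ∎

    name-fixed : {φ : X ⇒ Ω} → LaterStable φ → Φ ∘ next Y ∘ ⌜ φ ⌝ ≈ ⌜ φ ⌝
    name-fixed {φ} φ-stable = curry-unique (φ ∘ π₂) _ _ transpose (⌜⌝-spec φ)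
      where
        transpose : eval ∘ ((Φ ∘ next Y ∘ ⌜ φ ⌝) ⁂id) ≈ φ ∘ π₂
        transpose = begin
          eval ∘ ((Φ ∘ next Y ∘ ⌜ φ ⌝) ⁂id)          ≈⟨ ∘-congˡ (⁂id-resp sym-assoc) ⟩
          eval ∘ (((Φ ∘ next Y) ∘ ⌜ φ ⌝) ⁂id)        ≈⟨ eval-⁂id-∘ (Φ ∘ next Y) ⌜ φ ⌝ ⟩
          (eval ∘ ((Φ ∘ next Y) ⁂id)) ∘ (⌜ φ ⌝ ⁂id)  ≈⟨ ∘-congʳ Φ-next ⟩
          (later ∘ next Ω ∘ eval) ∘ (⌜ φ ⌝ ⁂id)      ≈⟨ ≈-trans assoc (∘-congˡ assoc) ⟩
          later ∘ next Ω ∘ eval ∘ (⌜ φ ⌝ ⁂id)        ≈⟨ ∘-congˡ (∘-congˡ (⌜⌝-spec φ)) ⟩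
          later ∘ next Ω ∘ φ ∘ π₂                    ≈⟨ ≈-trans (∘-congˡ sym-assoc) sym-assoc ⟩
          (later ∘ next Ω ∘ φ) ∘ π₂                  ≈⟨ ∘-congʳ φ-stable ⟩
          φ ∘ π₂                                     ∎

    later-stable-unique : {φ ψ : X ⇒ Ω} → LaterStable φ → LaterStable ψ → φ ≈ ψ
    later-stable-unique φ-stable ψ-stable =
      ⌜⌝-injective (fix-unique Φ _ _ (name-fixed φ-stable) (name-fixed ψ-stable))

corollary6p10 : ∀ {o ℓ e : Level} (𝓔 : Topos o ℓ e) (G : GuardedModel 𝓔)
    {M X : Category.Obj (Topos.cat 𝓔)} (m : Category._⇒_ (Topos.cat 𝓔) M X) →
    Mono (Topos.cat 𝓔) m →
    _≤ₛ_ (Topos.cat 𝓔) (GuardedModel.▷ G m) m →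
    (_≤ₛ_ (Topos.cat 𝓔) (Category.id (Topos.cat 𝓔) {X}) m
    × _≤ₛ_ (Topos.cat 𝓔) m (Category.id (Topos.cat 𝓔) {X}))
corollary6p10 𝓔 G {X = X} m m-mono ▷m≤m = id≤m , (m , identityˡ)
  where
    open Topos 𝓔
    open Category cat
    open ToposFacts 𝓔
    open GuardedFacts 𝓔 G
    χₘ : X ⇒ Ω
    χₘ = proj₁ (classify m m-mono)
    χₘ-classifies : IsPullback cat χₘ true m !
    χₘ-classifies = proj₂ (classify m m-mono)
    χₘ-stable : LaterStable χₘ
    χₘ-stable = ▷-closed⇒later-stable m-mono χₘ-classifies ▷m≤m
    χₘ≈true : χₘ ≈ true ∘ !
    χₘ≈true = LaterStableUnique.later-stable-unique X χₘ-stable true-later-stable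
    id≤m : _≤ₛ_ cat id m
    id≤m = classified-by-true⇒total χₘ-classifies χₘ≈true
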